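{- Let $G=(V,E)$ be an undirected, unweighted graph, $z\in V$, $k$ an integer and $r$ a rational number. If there is an edge set $S$ with $S\cap E=\emptyset$ and $|S|\le k$ such that $c_z\ge r$ in $(V,E\cup S)$, then there is such an edge set $S'$ (with $S'\cap E=\emptyset$, $|S'|\le k$, and $c_z\ge r$ in $(V,E\cup S')$) all of whose edges contain $z$.
   Context: For an undirected, unweighted graph $G=(V,E)$ and $z\in V$, the closeness centrality of $z$ is $c_z=\sum_{u\in V,\,u\neq z,\,d(u,z)<\infty}\frac{1}{d(z,u)}$, where $d(u,v)$ is the number of edges of a shortest $u$-$v$ path ($\infty$ if none exists). -}

module Defs where

open import Data.Nat using (ℕ; zero; suc)
open import Data.Fin using (Fin; toℕ; _≟_)
open import Data.Bool using (Bool; true; false; _∧_; _∨_; if_then_else_)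
open import Data.Product using (_×_; _,_; proj₁; proj₂)
open import Data.Maybe using (Maybe; just; nothing)
open import Data.Bool.ListAction using (any)
open import Data.List using (List; allFin; foldr; map; length; _++_)
open import Data.List.Relation.Unary.All using (All)
open import Data.List.Relation.Unary.Unique.Propositional using (Unique)
open import Data.Integer using (ℤ; +_)
open import Data.Rational using (ℚ; 0ℚ; _+_; _/_)
open import Relation.Nullary.Decidable using (⌊_⌋)
import Data.Nat as ℕ
open import Data.Sum using (_⊎_)
open import Relation.Binary.PropositionalEquality using (_≡_)

-- An (undirected, loopless) edge on vertex set Fin n is stored canonically
-- as a pair (u , v) with u < v.  An edge set is a duplicate-free list of
-- canonical pairs; its cardinality is its length.
Edge : ℕ → Set
Edge n = Fin n × Fin n

CanonicalEdge : ∀ {n} → Edge n → Set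
CanonicalEdge (u , v) = toℕ u ℕ.< toℕ v

EdgeSet : ℕ → Set
EdgeSet n = List (Edge n)

ValidEdgeSet : ∀ {n} → EdgeSet n → Set
ValidEdgeSet S = All CanonicalEdge S × Unique S

eqF : ∀ {n} → Fin n → Fin n → Bool
eqF u v = ⌊ u ≟ v ⌋

adj : ∀ {n} → EdgeSet n → Fin n → Fin n → Bool
adj E u v = any (λ e → (eqF (proj₁ e) u ∧ eqF (proj₂ e) v)
                     ∨ (eqF (proj₁ e) v ∧ eqF (proj₂ e) u)) E

reachWithin : ∀ {n} → EdgeSet n → ℕ → Fin n → Fin n → Bool
reachWithin {n} E zero    u v = eqF u v
reachWithin {n} E (suc k) u v =
  reachWithin E k u v ∨ any (λ w → reachWithin E k u w ∧ adj E w v) (allFin n)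

searchDist : ∀ {n} → EdgeSet n → Fin n → Fin n → ℕ → ℕ → Maybe ℕ
searchDist E u v k zero = if reachWithin E k u v then just k else nothing
searchDist E u v k (suc fuel) =
  if reachWithin E k u v then just k else searchDist E u v (suc k) fuel

-- shortest-path distance d(u,v) (nothing = ∞).  A shortest path in a graph
-- on n vertices has fewer than n edges, so searching k = 0 .. n suffices.
dist : ∀ {n} → EdgeSet n → Fin n → Fin n → Maybe ℕ
dist {n} E u v = searchDist E u v 0 n

invDist : Maybe ℕ → ℚ
invDist (just (suc m)) = + 1 / suc m
invDist _              = 0ℚ

sumℚ : List ℚ → ℚ
sumℚ = foldr _+_ 0ℚ

closeness : ∀ {n} → EdgeSet n → Fin n → ℚ
closeness {n} E z =
  sumℚ (map (λ u → if eqF u z then 0ℚ else invDist (dist E z u)) (allFin n))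

Incident : ∀ {n} → Fin n → Edge n → Set
Incident z e = (proj₁ e ≡ z) ⊎ (proj₂ e ≡ z)

-- Let G = E ∪ S and replace every added edge {w, x} ∈ S by the edge {z, x}
-- to its endpoint x farther from z (dropping the ones already in E or
-- degenerate).  The new set S′ has at most |S| edges, all at z, and no
-- distance from z grows: by induction on d, every vertex reached from z in
-- at most d steps of G is still reached in at most d steps of E ∪ S′, since
-- a vertex first reached across an edge of S is now adjacent to z.
-- Smaller distances mean larger summands 1 / d(z, u), so c_z does not drop.
module Submission where

open import Defs
open import Data.Nat using (ℕ)
open import Data.Fin using (Fin)
open import Data.Product using (Σ; _×_)
open import Data.List using (length; _++_)
open import Data.List.Relation.Unary.All using (All)
open import Data.List.Membership.Propositional using (_∉_)
open import Data.Integer using (ℤ; +_) renaming (_≤_ to _≤ℤ_)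
open import Data.Rational using (ℚ; _≤_)

open import Data.Nat as ℕ using (zero; suc; z≤n; s≤s)
import Data.Nat.Properties as ℕ
import Data.Fin as Fin
import Data.Fin.Properties as Fin
open import Data.Bool using (true; false; T; _∧_; if_then_else_)
open import Data.Bool.Properties using (T-≡; T-∧; T-∨)
open import Data.Empty using (⊥-elim)
open import Data.Maybe using (just; nothing; fromMaybe)
import Data.Maybe.Properties as Maybe
open import Data.Product using (∃; ∃₂; _,_; proj₁; proj₂)
import Data.Product.Properties as Product
open import Data.Sum using (_⊎_; inj₁; inj₂)
open import Data.List using ([]; _∷_; allFin; map; filter; deduplicate)
import Data.List.Properties as List
open import Data.List.Membership.Propositional using (_∈_; find)
import Data.List.Membership.Propositional.Properties as ∈
import Data.List.Membership.DecPropositional as DecMembership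
open import Data.List.Relation.Binary.Subset.Propositional using (_⊆_)
open import Data.List.Relation.Binary.Subset.Propositional.Properties using (xs⊆xs++ys)
import Data.List.Relation.Unary.Any as Any
open import Data.List.Relation.Unary.Any.Properties using (any⁺; any⁻)
import Data.List.Relation.Unary.All as All
import Data.List.Relation.Unary.All.Properties as All
import Data.List.Relation.Unary.Unique.Propositional.Properties as Unique
import Data.List.Relation.Unary.Unique.DecPropositional.Properties as Unique
import Data.Integer as ℤ
import Data.Integer.Properties as ℤ
import Data.Rational as ℚ
import Data.Rational.Properties as ℚ
open import Data.Nat.Coprimality using (1-coprimeTo)
open import Function using (Equivalence)
open import Relation.Nullary using (¬_; Dec; yes; no; ¬?)
open import Relation.Nullary.Decidable using (T?; _×-dec_; map′; toWitness; fromWitness)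
open import Relation.Binary.PropositionalEquality

open Equivalence using (to; from)

private
  variable
    n : ℕ

eqF-refl : (u : Fin n) → T (eqF u u)
eqF-refl u = fromWitness refl

eqF∧eqF-sound : ∀ {a b u v : Fin n} → T (eqF a u ∧ eqF b v) → (a , b) ≡ (u , v)
eqF∧eqF-sound {a = a} {b} {u} {v} h with T-∧ {eqF a u} {eqF b v} .to h
... | a≡u , b≡v = cong₂ _,_ (toWitness {a? = a Fin.≟ u} a≡u) (toWitness {a? = b Fin.≟ v} b≡v)

Adjacent : EdgeSet n → Fin n → Fin n → Set
Adjacent A u v = (u , v) ∈ A ⊎ (v , u) ∈ A

module _ {A : EdgeSet n} {u v : Fin n} where

  adj⁺ : Adjacent A u v → T (adj A u v)
  adj⁺ (inj₁ uv∈A) =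
    any⁺ _ (Any.map (λ { refl → T-∨ .from (inj₁ (T-∧ .from (eqF-refl u , eqF-refl v))) }) uv∈A)
  adj⁺ (inj₂ vu∈A) =
    any⁺ _ (Any.map (λ { refl → T-∨ .from (inj₂ (T-∧ .from (eqF-refl v , eqF-refl u))) }) vu∈A)

  adj⁻ : T (adj A u v) → Adjacent A u v
  adj⁻ h with find (any⁻ _ A h)
  ... | (a , b) , ab∈A , matches with T-∨ {eqF a u ∧ eqF b v} .to matches
  ... | inj₁ ab≡uv with eqF∧eqF-sound {a = a} {b} {u} {v} ab≡uv
  ...   | refl = inj₁ ab∈A
  adj⁻ h | (a , b) , ab∈A , _ | inj₂ ab≡vu with eqF∧eqF-sound {a = a} {b} {v} {u} ab≡vu
  ...   | refl = inj₂ ab∈A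

  Adjacent-⊆ : {B : EdgeSet n} → A ⊆ B → Adjacent A u v → Adjacent B u v
  Adjacent-⊆ A⊆B (inj₁ uv∈A) = inj₁ (A⊆B uv∈A)
  Adjacent-⊆ A⊆B (inj₂ vu∈A) = inj₂ (A⊆B vu∈A)

  Adjacent-++⁻ : (B : EdgeSet n) → Adjacent (A ++ B) u v → Adjacent A u v ⊎ Adjacent B u v
  Adjacent-++⁻ B (inj₁ uv∈A++B) with ∈.∈-++⁻ A uv∈A++B
  ... | inj₁ uv∈A = inj₁ (inj₁ uv∈A)
  ... | inj₂ uv∈B = inj₂ (inj₁ uv∈B)
  Adjacent-++⁻ B (inj₂ vu∈A++B) with ∈.∈-++⁻ A vu∈A++B
  ... | inj₁ vu∈A = inj₁ (inj₂ vu∈A)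
  ... | inj₂ vu∈B = inj₂ (inj₂ vu∈B)

-- A record around T (reachWithin A k u v), so that A, k, u and v are inferable.
record Reaches (A : EdgeSet n) (k : ℕ) (u v : Fin n) : Set where
  constructor ⟨_⟩
  field reached : T (reachWithin A k u v)

open Reaches

module _ {A : EdgeSet n} where

  reach-zero : ∀ {u} → Reaches A 0 u u
  reach-zero {u} = ⟨ eqF-refl u ⟩

  reach-zero⁻ : ∀ {u v} → Reaches A 0 u v → u ≡ v
  reach-zero⁻ {u} {v} r = toWitness {a? = u Fin.≟ v} (reached r)

  reach-suc : ∀ {k u v} → Reaches A k u v → Reaches A (suc k) u v
  reach-suc r = ⟨ T-∨ .from (inj₁ (reached r)) ⟩

  reach-+ : ∀ {k u v} o → Reaches A k u v → Reaches A (o ℕ.+ k) u v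
  reach-+ zero    r = r
  reach-+ (suc o) r = reach-suc (reach-+ o r)

  reach-mono : ∀ {k j u v} → k ℕ.≤ j → Reaches A k u v → Reaches A j u v
  reach-mono {k} {j} k≤j r = subst (λ i → Reaches A i _ _) (ℕ.m∸n+n≡m k≤j) (reach-+ (j ℕ.∸ k) r)

  reach-step : ∀ {k u w v} → Reaches A k u w → Adjacent A w v → Reaches A (suc k) u v
  reach-step {w = w} u⇝w w~v = ⟨ T-∨ .from (inj₂ (any⁺ _ (Any.map
    (λ { refl → T-∧ .from (reached u⇝w , adj⁺ w~v) }) (∈.∈-allFin w)))) ⟩

  reach-suc⁻ : ∀ {k u v} → Reaches A (suc k) u v →
               Reaches A k u v ⊎ ∃ λ w → Reaches A k u w × Adjacent A w v
  reach-suc⁻ r with T-∨ .to (reached r)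
  ... | inj₁ u⇝v = inj₁ ⟨ u⇝v ⟩
  ... | inj₂ via with find (any⁻ _ (allFin n) via)
  ...   | w , _ , u⇝w∧w~v with T-∧ .to u⇝w∧w~v
  ...     | u⇝w , w~v = inj₂ (w , ⟨ u⇝w ⟩ , adj⁻ w~v)

  reaches? : ∀ k u v → Dec (Reaches A k u v)
  reaches? k u v = map′ ⟨_⟩ reached (T? (reachWithin A k u v))

  searchDist-complete : ∀ {u v} fuel k {j} → k ℕ.≤ j → j ℕ.≤ fuel ℕ.+ k → Reaches A j u v →
                        ∃ λ b → searchDist A u v k fuel ≡ just b × b ℕ.≤ j
  searchDist-complete {u} {v} zero k k≤j j≤k r with ℕ.≤-antisym k≤j j≤k
  ... | refl with reachWithin A k u v in eq
  ...   | true  = k , refl , ℕ.≤-refl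
  ...   | false = ⊥-elim (subst T eq (reached r))
  searchDist-complete {u} {v} (suc fuel) k {j} k≤j j≤ r with reachWithin A k u v in eq
  ... | true  = k , refl , k≤j
  ... | false =
    searchDist-complete fuel (suc k) k<j (subst (j ℕ.≤_) (sym (ℕ.+-suc fuel k)) j≤) r
    where
    k<j : k ℕ.< j
    k<j = ℕ.≤∧≢⇒< k≤j (λ { refl → subst T eq (reached r) })

  searchDist-sound : ∀ {u v b} fuel k → searchDist A u v k fuel ≡ just b →
                     Reaches A b u v × b ℕ.≤ fuel ℕ.+ k
  searchDist-sound {u} {v} zero k e with reachWithin A k u v in eq
  searchDist-sound zero k refl | true = ⟨ T-≡ .from eq ⟩ , ℕ.≤-refl
  searchDist-sound {u} {v} {b} (suc fuel) k e with reachWithin A k u v in eq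
  searchDist-sound (suc fuel) k refl | true = ⟨ T-≡ .from eq ⟩ , ℕ.m≤n+m k (suc fuel)
  ... | false with searchDist-sound fuel (suc k) e
  ...   | u⇝v , b≤ = u⇝v , subst (b ℕ.≤_) (ℕ.+-suc fuel k) b≤

  dist-complete : ∀ {u v j} → j ℕ.≤ n → Reaches A j u v → ∃ λ b → dist A u v ≡ just b × b ℕ.≤ j
  dist-complete j≤n = searchDist-complete n 0 z≤n (subst (_ ℕ.≤_) (sym (ℕ.+-identityʳ n)) j≤n)

  dist-sound : ∀ {u v b} → dist A u v ≡ just b → Reaches A b u v × b ℕ.≤ n
  dist-sound {u} {v} e with searchDist-sound {u} {v} n 0 e
  ... | u⇝v , b≤ = u⇝v , subst (_ ℕ.≤_) (ℕ.+-identityʳ n) b≤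

  dist-self : ∀ {u b} → dist A u u ≡ just b → b ≡ 0
  dist-self {u} e with dist-complete {u} {u} z≤n reach-zero
  ... | _ , e′ , z≤n = Maybe.just-injective (trans (sym e) e′)

  dist-<-frontier : ∀ {d z w x} → suc d ℕ.≤ n → ¬ Reaches A d z x → Reaches A d z w → Adjacent A w x →
                    ∃₂ λ b c → dist A z w ≡ just b × dist A z x ≡ just c × b ℕ.< c
  dist-<-frontier sd≤n z⇏x z⇝w w~x with dist-complete (ℕ.<⇒≤ sd≤n) z⇝w
                                    | dist-complete sd≤n (reach-step z⇝w w~x)
  ... | b , dw , b≤d | c , dx , _ = b , c , dw , dx , ℕ.≤-<-trans b≤d d<c
    where
    d<c : _ ℕ.< c
    d<c = ℕ.≰⇒> (λ c≤d → z⇏x (reach-mono c≤d (proj₁ (dist-sound dx))))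

-- Radii beyond n are never inspected by dist.
ReachDominated : Fin n → EdgeSet n → EdgeSet n → Set
ReachDominated {n} z G H = ∀ {d x} → d ℕ.≤ n → Reaches G d z x → Reaches H d z x

1/suc≡mkℚ : ∀ m → (+ 1 ℚ./ suc m) ≡ ℚ.mkℚ (+ 1) m (1-coprimeTo (suc m))
1/suc≡mkℚ m = ℚ.↥p/↧p≡p (ℚ.mkℚ (+ 1) m (1-coprimeTo (suc m)))

1/suc-antitone : ∀ {m m′} → m′ ℕ.≤ m → (+ 1 ℚ./ suc m) ≤ (+ 1 ℚ./ suc m′)
1/suc-antitone {m} {m′} m′≤m rewrite 1/suc≡mkℚ m | 1/suc≡mkℚ m′ =
  ℚ.*≤* (subst₂ ℤ._≤_ (sym (ℤ.*-identityˡ _)) (sym (ℤ.*-identityˡ _)) (ℤ.+≤+ (s≤s m′≤m)))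

invDist-nonneg : ∀ d → ℚ.0ℚ ≤ invDist d
invDist-nonneg (just (suc m)) rewrite 1/suc≡mkℚ m = ℚ.*≤* (ℤ.+≤+ z≤n)
invDist-nonneg (just zero)    = ℚ.≤-refl
invDist-nonneg nothing        = ℚ.≤-refl

sumℚ-mono : {A : Set} (f g : A → ℚ) → (∀ a → f a ≤ g a) → ∀ xs → sumℚ (map f xs) ≤ sumℚ (map g xs)
sumℚ-mono f g f≤g []       = ℚ.≤-refl
sumℚ-mono f g f≤g (x ∷ xs) = ℚ.+-mono-≤ (f≤g x) (sumℚ-mono f g f≤g xs)

module _ {z : Fin n} {G H : EdgeSet n} (dominated : ReachDominated z G H) where

  invDist-dominated : ∀ {u} → u ≢ z → invDist (dist G z u) ≤ invDist (dist H z u)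
  invDist-dominated {u} u≢z with dist G z u in eq
  ... | nothing     = invDist-nonneg (dist H z u)
  ... | just zero   = invDist-nonneg (dist H z u)
  ... | just (suc m) with dist-sound eq
  ...   | z⇝u , sm≤n with dist-complete sm≤n (dominated sm≤n z⇝u)
  ...     | zero , eq′ , _ = ⊥-elim (u≢z (sym (reach-zero⁻ (proj₁ (dist-sound {A = H} eq′)))))
  ...     | suc m′ , eq′ , s≤s m′≤m rewrite eq′ = 1/suc-antitone m′≤m

  closeness-dominated : closeness G z ≤ closeness H z
  closeness-dominated = sumℚ-mono _ _ term≤ (allFin _)
    where
    term≤ : ∀ u → (if eqF u z then ℚ.0ℚ else invDist (dist G z u))
                ≤ (if eqF u z then ℚ.0ℚ else invDist (dist H z u))
    term≤ u with eqF u z in eq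
    ... | true  = ℚ.≤-refl
    ... | false = invDist-dominated (λ { refl → subst T eq (eqF-refl u) })

ShortcutsFrom : Fin n → EdgeSet n → EdgeSet n → EdgeSet n → Set
ShortcutsFrom z E S H = ∀ {w x b c} → Adjacent S w x →
  dist (E ++ S) z w ≡ just b → dist (E ++ S) z x ≡ just c → b ℕ.< c → Adjacent H z x

reach-shortcut : {z : Fin n} {E S H : EdgeSet n} → E ⊆ H → ShortcutsFrom z E S H →
                 ReachDominated z (E ++ S) H
reach-shortcut {z = z} {E} {S} {H} E⊆H shortcut = go
  where
  go : ReachDominated z (E ++ S) H
  go {zero}          _     z⇝x = subst (Reaches H 0 z) (reach-zero⁻ z⇝x) reach-zero
  go {suc d} {x} sd≤n z⇝x with reaches? d z x
  ... | yes z⇝x′ = reach-suc (go (ℕ.<⇒≤ sd≤n) z⇝x′)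
  ... | no z⇏x with reach-suc⁻ z⇝x
  ...   | inj₁ z⇝x′ = ⊥-elim (z⇏x z⇝x′)
  ...   | inj₂ (w , z⇝w , w~x) with Adjacent-++⁻ S w~x
  ...     | inj₁ w~ₑx = reach-step (go (ℕ.<⇒≤ sd≤n) z⇝w) (Adjacent-⊆ E⊆H w~ₑx)
  ...     | inj₂ w~ₛx with dist-<-frontier sd≤n z⇏x z⇝w w~x
  ...       | _ , _ , dw , dx , b<c =
    reach-mono (s≤s z≤n) (reach-step reach-zero (shortcut w~ₛx dw dx b<c))

_≟ₑ_ : (e f : Edge n) → Dec (e ≡ f)
_≟ₑ_ = Product.≡-dec Fin._≟_ Fin._≟_

Fresh : EdgeSet n → Edge n → Set
Fresh E e = CanonicalEdge e × e ∉ E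

fresh? : (E : EdgeSet n) (e : Edge n) → Dec (Fresh E e)
fresh? E (u , v) = (u Fin.<? v) ×-dec ¬? (DecMembership._∈?_ _≟ₑ_ (u , v) E)

prune : EdgeSet n → EdgeSet n → EdgeSet n
prune E L = filter (fresh? E) (deduplicate _≟ₑ_ L)

module _ (E L : EdgeSet n) where

  prune-valid : ValidEdgeSet (prune E L)
  prune-valid = All.map proj₁ (All.all-filter (fresh? E) (deduplicate _≟ₑ_ L))
              , Unique.filter⁺ (fresh? E) (Unique.deduplicate-! _≟ₑ_ L)

  prune-fresh : All (_∉ E) (prune E L)
  prune-fresh = All.map proj₂ (All.all-filter (fresh? E) (deduplicate _≟ₑ_ L))

  length-prune : length (prune E L) ℕ.≤ length L
  length-prune = ℕ.≤-trans (List.length-filter (fresh? E) (deduplicate _≟ₑ_ L))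
                           (List.length-deduplicate _≟ₑ_ L)

  ∈-prune⁻ : ∀ {e} → e ∈ prune E L → e ∈ L
  ∈-prune⁻ e∈ = ∈.∈-deduplicate⁻ _≟ₑ_ L (proj₁ (∈.∈-filter⁻ (fresh? E) e∈))

  ∈-prune⁺ : ∀ {e} → e ∈ L → CanonicalEdge e → e ∈ E ++ prune E L
  ∈-prune⁺ {e} e∈L canonical with DecMembership._∈?_ _≟ₑ_ e E
  ... | yes e∈E = ∈.∈-++⁺ˡ e∈E
  ... | no e∉E  =
    ∈.∈-++⁺ʳ E (∈.∈-filter⁺ (fresh? E) (∈.∈-deduplicate⁺ _≟ₑ_ e∈L) (canonical , e∉E))

edgeTo : Fin n → Fin n → Edge n
edgeTo z x with z Fin.<? x
... | yes _ = (z , x)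
... | no _  = (x , z)

module _ {z x : Fin n} where

  edgeTo-incident : Incident z (edgeTo z x)
  edgeTo-incident with z Fin.<? x
  ... | yes _ = inj₁ refl
  ... | no _  = inj₂ refl

  edgeTo-canonical : x ≢ z → CanonicalEdge (edgeTo z x)
  edgeTo-canonical x≢z with z Fin.<? x
  ... | yes z<x = z<x
  ... | no z≮x  = Fin.≤∧≢⇒< (ℕ.≮⇒≥ z≮x) x≢z

  edgeTo-adjacent : {A : EdgeSet n} → edgeTo z x ∈ A → Adjacent A z x
  edgeTo-adjacent with z Fin.<? x
  ... | yes _ = inj₁
  ... | no _  = inj₂

farther : (Fin n → ℕ) → Edge n → Fin n
farther h (u , v) with h u ℕ.<? h v
... | yes _ = v
... | no _  = u

farther-< : ∀ {h : Fin n → ℕ} {w x} → h w ℕ.< h x → farther h (w , x) ≡ x × farther h (x , w) ≡ x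
farther-< {h = h} {w} {x} hw<hx with h w ℕ.<? h x | h x ℕ.<? h w
... | yes _ | yes hx<hw = ⊥-elim (ℕ.<-asym hw<hx hx<hw)
... | yes _ | no _      = refl , refl
... | no hw≮hx | _      = ⊥-elim (hw≮hx hw<hx)

farther-∈ : ∀ {h : Fin n → ℕ} {S w x} → Adjacent S w x → h w ℕ.< h x → x ∈ map (farther h) S
farther-∈ {h = h} (inj₁ wx∈S) hw<hx =
  subst (_∈ _) (proj₁ (farther-< {h = h} hw<hx)) (∈.∈-map⁺ (farther h) wx∈S)
farther-∈ {h = h} (inj₂ xw∈S) hw<hx =
  subst (_∈ _) (proj₂ (farther-< {h = h} hw<hx)) (∈.∈-map⁺ (farther h) xw∈S)

module Shortcutting (E S : EdgeSet n) (z : Fin n) where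

  -- Unreachable vertices get level n; they are never compared in shortcuts.
  level : Fin n → ℕ
  level x = fromMaybe n (dist (E ++ S) z x)

  candidates : EdgeSet n
  candidates = map (edgeTo z) (map (farther level) S)

  S′ : EdgeSet n
  S′ = prune E candidates

  S′-incident : All (Incident z) S′
  S′-incident = All.tabulate λ e∈S′ → incident (∈.∈-map⁻ _ (∈-prune⁻ E candidates e∈S′))
    where
    incident : ∀ {e} → ∃ (λ x → x ∈ map (farther level) S × e ≡ edgeTo z x) → Incident z e
    incident (x , _ , refl) = edgeTo-incident {x = x}

  length-S′ : length S′ ℕ.≤ length S
  length-S′ = begin
    length S′                       ≤⟨ length-prune E candidates ⟩
    length candidates               ≡⟨ List.length-map (edgeTo z) (map (farther level) S) ⟩
    length (map (farther level) S)  ≡⟨ List.length-map (farther level) S ⟩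
    length S                        ∎
    where open ℕ.≤-Reasoning

  shortcuts : ShortcutsFrom z E S (E ++ S′)
  shortcuts {w} {x} w~ₛx dw dx b<c =
    edgeTo-adjacent (∈-prune⁺ E candidates (∈.∈-map⁺ (edgeTo z) (farther-∈ w~ₛx level-<))
                                           (edgeTo-canonical x≢z))
    where
    level-< : level w ℕ.< level x
    level-< = subst₂ ℕ._<_ (sym (cong (fromMaybe n) dw)) (sym (cong (fromMaybe n) dx)) b<c

    x≢z : x ≢ z
    x≢z refl with dist-self {A = E ++ S} dx
    ... | refl = ℕ.n≮0 b<c

lemma1 : (n : ℕ) (E : EdgeSet n) → ValidEdgeSet E → (z : Fin n) (k : ℤ) (r : ℚ) →
    Σ (EdgeSet n) (λ S → ValidEdgeSet S × All (_∉ E) S × (+ length S ≤ℤ k) × (r ≤ closeness (E ++ S) z)) →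
    Σ (EdgeSet n) (λ S′ → ValidEdgeSet S′ × All (_∉ E) S′ × (+ length S′ ≤ℤ k) × (r ≤ closeness (E ++ S′) z) × All (Incident z) S′)
lemma1 n E _ z k r (S , _ , _ , |S|≤k , r≤c) =
  S′ , prune-valid E candidates , prune-fresh E candidates , |S′|≤k , r≤c′ , S′-incident
  where
  open Shortcutting E S z

  |S′|≤k : + length S′ ≤ℤ k
  |S′|≤k = ℤ.≤-trans (ℤ.+≤+ length-S′) |S|≤k

  r≤c′ : r ≤ closeness (E ++ S′) z
  r≤c′ = ℚ.≤-trans r≤c (closeness-dominated (reach-shortcut (xs⊆xs++ys E S′) shortcuts))
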